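{- Let $\mathbb{M}$ be a monster model of $T_{\log}$ with underlying set $\Gamma_\infty=\Gamma\cup\{\infty\}$, and let $I=I_1+(c)+I_2$ be an ordered index set with $I_1,I_2$ infinite. Let $(a_ia_i')_{i\in I}$ be an indiscernible sequence from $\Gamma\times\Psi$ such that $(a_i)$ and $(a_i')$ are each nonconstant, and suppose $b\in\Gamma$ is such that $(a_ia_i')_{i\in I_1+I_2}$ is $b$-indiscernible. Then: (1) if $\psi(a_i-b)=a_i'$ for all $i\ne c$, then $\psi(a_c-b)=a_c'$; (2) if $s(a_i-b)=a_i'$ for all $i\ne c$, then $s(a_c-b)=a_c'$; (3) if $p(a_i-b)=a_i'$ for all $i\ne c$, then $p(a_c-b)=a_c'$.
   Context: $\mathcal{L}_{\log}=\{0,+,-,<,\psi,\infty,s,p,\delta_1,\delta_2,\ldots\}$. An asymptotic couple is $(\Gamma,\psi)$ with $\Gamma$ an ordered abelian group, $\psi:\Gamma\setminus\{0\}\to\Gamma$ with, for nonzero $\alpha,\beta$: $\alpha+\beta\ne0\Rightarrow\psi(\alpha+\beta)\ge\min(\psi(\alpha),\psi(\beta))$; $\psi(k\alpha)=\psi(\alpha)$ for nonzero integers $k$; $\alpha>0\Rightarrow\alpha+\psi(\alpha)>\psi(\beta)$; $H$-type: $0<\alpha\le\beta\Rightarrow\psi(\alpha)\ge\psi(\beta)$. $\psi(0)=\infty$, $\Psi=\psi(\Gamma\setminus\{0\})$, $\alpha'=\alpha+\psi(\alpha)$; asymptotic integration: each $\gamma$ equals $\alpha'$ for a unique $\alpha\neq0$,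 written $\int\gamma$; $s(\gamma)=\psi(\int\gamma)$. Models of $T_{\log}$: divisible $H$-asymptotic couples with asymptotic integration such that $\Psi$ has least element $s(0)>0$, each $\alpha\in\Psi$ has immediate successor $s(\alpha)$ in $\Psi$, and $s:\Psi\to\Psi^{>s(0)}$ is a bijection; $p$ is its inverse on $\Psi^{>s(0)}$ and $\infty$ elsewhere; underlying set $\Gamma\cup\{\infty\}$, $\Gamma<\infty$, $\delta_n$ division by $n$, $\infty$ default value of all functions. Indiscernibility is in $\mathcal{L}_{\log}$ ("indiscernible" means $\emptyset$-indiscernible). -}

module Defs where

open import Data.Nat using (ℕ; zero; suc; _+_)
open import Data.Fin using (Fin; splitAt) renaming (zero to fzero; suc to fsuc; _<_ to _<ᶠ_)
open import Data.Maybe using (Maybe; just; nothing)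
open import Data.Product using (Σ; _×_; _,_)
open import Data.Sum using (_⊎_; [_,_])
open import Data.Empty using (⊥)
open import Data.Unit using (⊤)
open import Relation.Nullary using (¬_)
open import Relation.Binary.PropositionalEquality using (_≡_; _≢_)
open import Function.Definitions using (Injective)

-- L_log-structures.  Γ is the underlying ordered group; the underlying
-- set of the L_log-structure is Γ∞ = Maybe Γ (nothing = ∞).
-- ψ, s, p are given on Γ with values in Γ∞ (their value at ∞ is ∞).
-- δ n is the division-by-(n+1) function δ_{n+1}.

record LogStructure : Set₁ where
  infixl 6 _+ᵍ_
  field
    Γ    : Set
    0ᵍ   : Γ
    _+ᵍ_ : Γ → Γ → Γ
    -ᵍ_  : Γ → Γ
    _<ᵍ_ : Γ → Γ → Set
    ψ    : Γ → Maybe Γ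
    s    : Γ → Maybe Γ
    p    : Γ → Maybe Γ
    δ    : ℕ → Γ → Γ

module LogDefs (S : LogStructure) where
  open LogStructure S

  Γ∞ : Set
  Γ∞ = Maybe Γ

  ∞ : Γ∞
  ∞ = nothing

  _-ᵍ_ : Γ → Γ → Γ
  x -ᵍ y = x +ᵍ (-ᵍ y)

  _≤ᵍ_ : Γ → Γ → Set
  x ≤ᵍ y = x <ᵍ y ⊎ x ≡ y

  _+∞_ : Γ∞ → Γ∞ → Γ∞
  just x +∞ just y = just (x +ᵍ y)
  _      +∞ _      = nothing

  -∞_ : Γ∞ → Γ∞
  -∞ just x = just (-ᵍ x)
  -∞ nothing = nothing

  lift∞ : (Γ → Γ∞) → Γ∞ → Γ∞
  lift∞ f (just x) = f x
  lift∞ f nothing  = nothing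

  map∞ : (Γ → Γ) → Γ∞ → Γ∞
  map∞ f (just x) = just (f x)
  map∞ f nothing  = nothing

  _<∞_ : Γ∞ → Γ∞ → Set
  just x  <∞ just y  = x <ᵍ y
  just x  <∞ nothing = ⊤
  nothing <∞ _       = ⊥

  _≤∞_ : Γ∞ → Γ∞ → Set
  x ≤∞ y = x <∞ y ⊎ x ≡ y

  times : ℕ → Γ → Γ
  times zero    x = 0ᵍ
  times (suc n) x = x +ᵍ times n x

  InΨ : Γ → Set
  InΨ x = Σ Γ λ α → α ≢ 0ᵍ × ψ α ≡ just x

  deriv : Γ → Γ∞
  deriv α = just α +∞ ψ α

record IsTlog (S : LogStructure) : Set where
  open LogStructure S
  open LogDefs S
  field
    +-assoc  : ∀ x y z → (x +ᵍ y) +ᵍ z ≡ x +ᵍ (y +ᵍ z)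
    +-comm   : ∀ x y → x +ᵍ y ≡ y +ᵍ x
    +-idʳ    : ∀ x → x +ᵍ 0ᵍ ≡ x
    +-invʳ   : ∀ x → x +ᵍ (-ᵍ x) ≡ 0ᵍ
    <-irrefl : ∀ x → ¬ (x <ᵍ x)
    <-trans  : ∀ x y z → x <ᵍ y → y <ᵍ z → x <ᵍ z
    <-tri    : ∀ x y → x <ᵍ y ⊎ x ≡ y ⊎ y <ᵍ x
    <-+      : ∀ x y z → x <ᵍ y → (x +ᵍ z) <ᵍ (y +ᵍ z)
    δ-div    : ∀ n x → times (suc n) (δ n x) ≡ x
    ψ-0      : ψ 0ᵍ ≡ ∞
    ψ-fin    : ∀ α → α ≢ 0ᵍ → Σ Γ λ β → ψ α ≡ just β
    ψ-add    : ∀ α β → α ≢ 0ᵍ → β ≢ 0ᵍ → (α +ᵍ β) ≢ 0ᵍ →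
               (ψ α ≤∞ ψ (α +ᵍ β)) ⊎ (ψ β ≤∞ ψ (α +ᵍ β))
    ψ-times  : ∀ n α → α ≢ 0ᵍ → ψ (times (suc n) α) ≡ ψ α
    ψ-neg    : ∀ α → α ≢ 0ᵍ → ψ (-ᵍ α) ≡ ψ α
    ψ-ac3    : ∀ α β → 0ᵍ <ᵍ α → β ≢ 0ᵍ → ψ β <∞ deriv α
    ψ-H      : ∀ α β → 0ᵍ <ᵍ α → α ≤ᵍ β → ψ β ≤∞ ψ α
    asint      : ∀ γ → Σ Γ λ α → α ≢ 0ᵍ × deriv α ≡ just γ
    asint-uniq : ∀ γ α β → α ≢ 0ᵍ → β ≢ 0ᵍ →
                 deriv α ≡ just γ → deriv β ≡ just γ → α ≡ β
    s-def    : ∀ γ α → α ≢ 0ᵍ → deriv α ≡ just γ → s γ ≡ ψ α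
    s0-min   : Σ Γ λ σ → s 0ᵍ ≡ just σ × InΨ σ × 0ᵍ <ᵍ σ ×
               (∀ x → InΨ x → σ ≤ᵍ x)
    s-succ   : ∀ α → InΨ α → Σ Γ λ β → s α ≡ just β × InΨ β × α <ᵍ β ×
               (∀ x → InΨ x → α <ᵍ x → β ≤ᵍ x)
    s-inj    : ∀ α β → InΨ α → InΨ β → s α ≡ s β → α ≡ β
    s-onto   : ∀ β → InΨ β → s 0ᵍ <∞ just β → Σ Γ λ α → InΨ α × s α ≡ just β
    p-def    : ∀ α β → InΨ α → s α ≡ just β → p β ≡ just α
    p-out    : ∀ β → ¬ (InΨ β × s 0ᵍ <∞ just β) → p β ≡ ∞

data Term (n : ℕ) : Set where
  var  : Fin n → Term n
  t0   : Term n
  t∞   : Term n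
  _t+_ : Term n → Term n → Term n
  t-   : Term n → Term n
  tψ   : Term n → Term n
  ts   : Term n → Term n
  tp   : Term n → Term n
  tδ   : ℕ → Term n → Term n     -- tδ n = δ_{n+1}

data Formula : ℕ → Set where
  _≐_  : ∀ {n} → Term n → Term n → Formula n
  _≺_  : ∀ {n} → Term n → Term n → Formula n
  ¬'_  : ∀ {n} → Formula n → Formula n
  _∧'_ : ∀ {n} → Formula n → Formula n → Formula n
  ∃'_  : ∀ {n} → Formula (suc n) → Formula n

module Semantics (S : LogStructure) where
  open LogStructure S
  open LogDefs S

  ⟦_⟧ : ∀ {n} → Term n → (Fin n → Γ∞) → Γ∞
  ⟦ var x ⟧ ρ   = ρ x
  ⟦ t0 ⟧ ρ      = just 0ᵍ
  ⟦ t∞ ⟧ ρ      = ∞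
  ⟦ t t+ u ⟧ ρ  = ⟦ t ⟧ ρ +∞ ⟦ u ⟧ ρ
  ⟦ t- t ⟧ ρ    = -∞ ⟦ t ⟧ ρ
  ⟦ tψ t ⟧ ρ    = lift∞ ψ (⟦ t ⟧ ρ)
  ⟦ ts t ⟧ ρ    = lift∞ s (⟦ t ⟧ ρ)
  ⟦ tp t ⟧ ρ    = lift∞ p (⟦ t ⟧ ρ)
  ⟦ tδ n t ⟧ ρ  = map∞ (δ n) (⟦ t ⟧ ρ)

  cons : ∀ {n} → Γ∞ → (Fin n → Γ∞) → Fin (suc n) → Γ∞
  cons x ρ fzero    = x
  cons x ρ (fsuc i) = ρ i

  Sat : ∀ {n} → Formula n → (Fin n → Γ∞) → Set
  Sat (t ≐ u)  ρ = ⟦ t ⟧ ρ ≡ ⟦ u ⟧ ρ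
  Sat (t ≺ u)  ρ = ⟦ t ⟧ ρ <∞ ⟦ u ⟧ ρ
  Sat (¬' φ)   ρ = ¬ Sat φ ρ
  Sat (φ ∧' χ) ρ = Sat φ ρ × Sat χ ρ
  Sat (∃' φ)   ρ = Σ Γ∞ λ x → Sat φ (cons x ρ)

  Increasing : {I : Set} → (I → I → Set) → ∀ {k} → (Fin k → I) → Set
  Increasing _<I_ {k} t = ∀ (x y : Fin k) → x <ᵍᶠ y → t x <I t y
    where _<ᵍᶠ_ = _<ᶠ_

  -- variable assignment: parameters, then a_{t 1..k}, then a'_{t 1..k}
  envOf : ∀ {I : Set} {m} (par : Fin m → Γ∞) (a a' : I → Γ) {k}
          (t : Fin k → I) → Fin (m + (k + k)) → Γ∞
  envOf {m = m} par a a' {k} t v =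
    [ par , (λ w → [ (λ x → just (a (t x))) , (λ x → just (a' (t x))) ] (splitAt k w)) ]
      (splitAt m v)

  IndiscernibleOver : {I : Set} (_<I_ : I → I → Set) (P : I → Set)
                      {m : ℕ} (par : Fin m → Γ∞) (a a' : I → Γ) → Set
  IndiscernibleOver {I} _<I_ P {m} par a a' =
    ∀ (k : ℕ) (φ : Formula (m + (k + k))) (t u : Fin k → I) →
    Increasing _<I_ t → Increasing _<I_ u →
    (∀ x → P (t x)) → (∀ x → P (u x)) →
    (Sat φ (envOf par a a' t) → Sat φ (envOf par a a' u)) ×
    (Sat φ (envOf par a a' u) → Sat φ (envOf par a a' t))

InfiniteSubset : {I : Set} → (I → Set) → Set
InfiniteSubset {I} P = Σ (ℕ → I) λ f → Injective _≡_ _≡_ f × (∀ n → P (f n))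

NonConstant : {I A : Set} → (I → A) → Set
NonConstant {I} f = Σ I λ i → Σ I λ j → f i ≢ f j

noParams : {A : Set} → Fin 0 → A
noParams ()

oneParam : {A : Set} → A → Fin 1 → A
oneParam b fzero = b

-- Pick i < c < j.  Indiscernibility and nonconstancy of (a'_k) give a'_i ≠ a'_j;
-- say a'_i < a'_j.  Since ψ(a_i − b) = a'_i < a'_j = ψ(a_j − b), the ultrametric
-- inequality gives ψ(a_i − a_j) = a'_i.  Together with a'_i < a'_j this is a formula
-- about the pair (i, j), so indiscernibility moves it to (c, j): ψ(a_c − a_j) = a'_c
-- < a'_j, and the ultrametric inequality once more yields ψ(a_c − b) = a'_c.  (If
-- a'_j < a'_i, move (i, j) to (i, c) instead.)  As s(γ) = δ iff ψ(γ − δ) = δ, part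
-- (2) is part (1) for the sequence a_k − a'_k.  For p, p(a_k − b) = a'_k means
-- s(a'_k) = a_k − b, so a_i − s(a'_i) = b = a_j − s(a'_j), an equation that moves
-- from (i, j) to (i, c).
module Submission where

open import Defs
open import Data.Maybe using (just)
open import Data.Unit using (⊤)
open import Data.Product using (_×_)
open import Relation.Binary.PropositionalEquality using (_≡_; _≢_)
open import Relation.Binary.Structures using (IsStrictTotalOrder)

open import Algebra.Bundles using (AbelianGroup)
open import Algebra.Consequences.Propositional using (comm∧idʳ⇒id; comm∧invʳ⇒inv)
import Algebra.Properties.AbelianGroup as AbelianGroupProperties
import Algebra.Properties.CommutativeSemigroup as CommutativeSemigroupProperties
open import Algebra.Structures using (IsAbelianGroup)
open import Data.Empty using (⊥-elim)
open import Data.Fin using (Fin) renaming (zero to fzero; suc to fsuc)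
open import Data.Maybe using (nothing)
open import Data.Maybe.Properties using (just-injective; ≡-dec)
open import Data.Nat using (s≤s)
open import Data.Product using (_,_; proj₁)
open import Data.Sum using (inj₁; inj₂)
open import Data.Unit using (tt)
open import Function.Bundles using (_⇔_; mk⇔; Equivalence)
open import Level using (0ℓ)
import Relation.Binary.Construct.StrictToNonStrict as StrictToNonStrict
open import Relation.Binary.Definitions
  using (DecidableEquality; Irreflexive; Transitive; tri<; tri≈; tri>)
open import Relation.Binary.PropositionalEquality
  using (refl; sym; trans; cong; cong₂; subst; subst₂; isEquivalence; module ≡-Reasoning)
open import Relation.Nullary using (yes; no)
open import Relation.Nullary.Decidable using (decidable-stable)

module Tlog (S : LogStructure) (T : IsTlog S) where
  open LogStructure S
  open LogDefs S
  open IsTlog T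

  +-isAbelianGroup : IsAbelianGroup _≡_ _+ᵍ_ 0ᵍ (-ᵍ_)
  +-isAbelianGroup = record
    { isGroup = record
      { isMonoid = record
        { isSemigroup = record
          { isMagma = record { isEquivalence = isEquivalence ; ∙-cong = cong₂ _+ᵍ_ }
          ; assoc = +-assoc
          }
        ; identity = comm∧idʳ⇒id +-comm +-idʳ
        }
      ; inverse = comm∧invʳ⇒inv +-comm +-invʳ
      ; ⁻¹-cong = cong (-ᵍ_)
      }
    ; comm = +-comm
    }

  +-abelianGroup : AbelianGroup 0ℓ 0ℓ
  +-abelianGroup = record { isAbelianGroup = +-isAbelianGroup }

  open AbelianGroupProperties +-abelianGroup
    using (⁻¹-anti-homo‿-; xyx⁻¹≈y; inverseˡ-unique; ε⁻¹≈ε; //-rightDividesˡ; //-rightDividesʳ; \\-leftDividesʳ)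
  open CommutativeSemigroupProperties (AbelianGroup.commutativeSemigroup +-abelianGroup)
    using (xy∙z≈xz∙y)

  x-[x-y]≡y : ∀ x y → x -ᵍ (x -ᵍ y) ≡ y
  x-[x-y]≡y x y = begin
    x -ᵍ (x -ᵍ y)      ≡⟨ cong (x +ᵍ_) (⁻¹-anti-homo‿- x y) ⟩
    x +ᵍ (y -ᵍ x)      ≡⟨ sym (+-assoc x y (-ᵍ x)) ⟩
    (x +ᵍ y) -ᵍ x      ≡⟨ xyx⁻¹≈y x y ⟩
    y                  ∎
    where open ≡-Reasoning

  [x-z]+[z-y]≡x-y : ∀ x y z → (x -ᵍ z) +ᵍ (z -ᵍ y) ≡ x -ᵍ y
  [x-z]+[z-y]≡x-y x y z = begin
    (x -ᵍ z) +ᵍ (z -ᵍ y)   ≡⟨ +-assoc x (-ᵍ z) (z -ᵍ y) ⟩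
    x +ᵍ (-ᵍ z +ᵍ (z -ᵍ y)) ≡⟨ cong (x +ᵍ_) (\\-leftDividesʳ z (-ᵍ y)) ⟩
    x -ᵍ y                 ∎
    where open ≡-Reasoning

  _≟ᵍ_ : DecidableEquality Γ
  x ≟ᵍ y with <-tri x y
  ... | inj₁ x<y        = no λ { refl → <-irrefl x x<y }
  ... | inj₂ (inj₁ x≡y) = yes x≡y
  ... | inj₂ (inj₂ y<x) = no λ { refl → <-irrefl x y<x }

  <∞-irrefl : Irreflexive _≡_ _<∞_
  <∞-irrefl {just x}  refl = <-irrefl x
  <∞-irrefl {nothing} refl ()

  <∞-trans : Transitive _<∞_
  <∞-trans {just x} {just y} {just z} = <-trans x y z
  <∞-trans {just x} {just y} {nothing} _ _ = tt
  <∞-trans {just x} {nothing} _ ()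
  <∞-trans {nothing} ()

  ≤∞-antisym : ∀ {x y} → x ≤∞ y → y ≤∞ x → x ≡ y
  ≤∞-antisym = StrictToNonStrict.antisym _≡_ _<∞_ isEquivalence
    (λ {x} {y} {z} → <∞-trans {x} {y} {z}) (λ {x} {y} → <∞-irrefl {x} {y})

  <∞-≤∞-trans : ∀ {x y z} → x <∞ y → y ≤∞ z → x <∞ z
  <∞-≤∞-trans {x} {y} {z} x<y (inj₁ y<z) = <∞-trans {x} {y} {z} x<y y<z
  <∞-≤∞-trans x<y (inj₂ refl) = x<y

  ψ≡just⇒≢0 : ∀ {x m} → ψ x ≡ just m → x ≢ 0ᵍ
  ψ≡just⇒≢0 ψx≡m refl with trans (sym ψ-0) ψx≡m
  ... | ()

  ψ[-x]≡ψ[x] : ∀ x → ψ (-ᵍ x) ≡ ψ x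
  ψ[-x]≡ψ[x] x with x ≟ᵍ 0ᵍ
  ... | yes refl = cong ψ ε⁻¹≈ε
  ... | no x≢0   = ψ-neg x x≢0

  ψ[x-y]≡ψ[y-x] : ∀ x y → ψ (x -ᵍ y) ≡ ψ (y -ᵍ x)
  ψ[x-y]≡ψ[y-x] x y = trans (sym (ψ[-x]≡ψ[x] (x -ᵍ y))) (cong ψ (⁻¹-anti-homo‿- x y))

  ψ-+-strict : ∀ {x y m n} → ψ x ≡ just m → ψ y ≡ just n → m <ᵍ n → ψ (x +ᵍ y) ≡ just m
  ψ-+-strict {x} {y} {m} {n} ψx ψy m<n = ≤∞-antisym upper lower
    where
    ψ[-y] : ψ (-ᵍ y) ≡ just n
    ψ[-y] = trans (ψ[-x]≡ψ[x] y) ψy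

    x+y≢0 : x +ᵍ y ≢ 0ᵍ
    x+y≢0 x+y≡0 = <-irrefl m (subst (m <ᵍ_) (sym m≡n) m<n)
      where
      m≡n : m ≡ n
      m≡n = just-injective (trans (sym ψx) (trans (cong ψ (inverseˡ-unique x y x+y≡0)) ψ[-y]))

    x+y-y≡x : (x +ᵍ y) -ᵍ y ≡ x
    x+y-y≡x = //-rightDividesʳ y x

    lower : just m ≤∞ ψ (x +ᵍ y)
    lower with ψ-add x y (ψ≡just⇒≢0 ψx) (ψ≡just⇒≢0 ψy) x+y≢0
    ... | inj₁ ψx≤ = subst (_≤∞ ψ (x +ᵍ y)) ψx ψx≤
    ... | inj₂ ψy≤ = inj₁ (<∞-≤∞-trans m<n (subst (_≤∞ ψ (x +ᵍ y)) ψy ψy≤))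

    upper : ψ (x +ᵍ y) ≤∞ just m
    upper with ψ-add (x +ᵍ y) (-ᵍ y) x+y≢0 (ψ≡just⇒≢0 ψ[-y])
                 (subst (_≢ 0ᵍ) (sym x+y-y≡x) (ψ≡just⇒≢0 ψx))
    ... | inj₁ ≤ψx = subst (ψ (x +ᵍ y) ≤∞_) (trans (cong ψ x+y-y≡x) ψx) ≤ψx
    ... | inj₂ n≤m = ⊥-elim (<∞-irrefl refl
                       (<∞-≤∞-trans m<n (subst₂ _≤∞_ ψ[-y] (trans (cong ψ x+y-y≡x) ψx) n≤m)))

  ψ-isosceles : ∀ {x y z m n} → ψ (x -ᵍ z) ≡ just m → ψ (y -ᵍ z) ≡ just n → m <ᵍ n →
                ψ (x -ᵍ y) ≡ just m
  ψ-isosceles {x} {y} {z} ψ[x-z] ψ[y-z] m<n =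
    trans (cong ψ (sym ([x-z]+[z-y]≡x-y x y z)))
          (ψ-+-strict ψ[x-z] (trans (ψ[x-y]≡ψ[y-x] z y) ψ[y-z]) m<n)

  s≡⇔ψ≡ : ∀ γ y → s γ ≡ just y ⇔ ψ (γ -ᵍ y) ≡ just y
  s≡⇔ψ≡ γ y = mk⇔ s⇒ψ ψ⇒s
    where
    s⇒ψ : s γ ≡ just y → ψ (γ -ᵍ y) ≡ just y
    s⇒ψ sγ with asint γ
    ... | α , α≢0 , α′≡γ = subst (λ β → ψ β ≡ just y) α≡γ-y ψα
      where
      ψα : ψ α ≡ just y
      ψα = trans (sym (s-def γ α α≢0 α′≡γ)) sγ
      α≡γ-y : α ≡ γ -ᵍ y
      α≡γ-y = trans (sym (//-rightDividesʳ y α))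
                    (cong (_-ᵍ y) (just-injective (trans (cong (just α +∞_) (sym ψα)) α′≡γ)))

    ψ⇒s : ψ (γ -ᵍ y) ≡ just y → s γ ≡ just y
    ψ⇒s ψ[γ-y] = trans (s-def γ (γ -ᵍ y) (ψ≡just⇒≢0 ψ[γ-y]) [γ-y]′≡γ) ψ[γ-y]
      where
      [γ-y]′≡γ : deriv (γ -ᵍ y) ≡ just γ
      [γ-y]′≡γ = trans (cong (just (γ -ᵍ y) +∞_) ψ[γ-y]) (cong just (//-rightDividesˡ y γ))

  s[x-b]≡y⇔ψ[x-y-b]≡y : ∀ x b y → s (x -ᵍ b) ≡ just y ⇔ ψ ((x -ᵍ y) -ᵍ b) ≡ just y
  s[x-b]≡y⇔ψ[x-y-b]≡y x b y =
    subst (λ γ → s (x -ᵍ b) ≡ just y ⇔ ψ γ ≡ just y) (xy∙z≈xz∙y x (-ᵍ b) (-ᵍ y)) (s≡⇔ψ≡ (x -ᵍ b) y)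

  -- p is defined by cases on the undecidable condition β ∈ Ψ^{>s(0)}; equality in
  -- Γ∞ is decidable, hence stable, which lets the case analysis go through.
  p≡⇒s≡ : ∀ {β α} → p β ≡ just α → s α ≡ just β
  p≡⇒s≡ {β} {α} pβ = decidable-stable (≡-dec _≟ᵍ_ (s α) (just β)) λ sα≢β →
    case-nothing (trans (sym (p-out β λ { (β∈Ψ , s0<β) → sα≢β (onto β∈Ψ s0<β) })) pβ)
    where
    case-nothing : nothing ≢ just α
    case-nothing ()
    onto : InΨ β → s 0ᵍ <∞ just β → s α ≡ just β
    onto β∈Ψ s0<β with s-onto β β∈Ψ s0<β
    ... | α₀ , α₀∈Ψ , sα₀ =
      subst (λ γ → s γ ≡ just β) (just-injective (trans (sym (p-def α₀ β α₀∈Ψ sα₀)) pβ)) sα₀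

  just-x-m≡b⇔m≡x-b : ∀ x b m → just x +∞ (-∞ m) ≡ just b ⇔ m ≡ just (x -ᵍ b)
  just-x-m≡b⇔m≡x-b x b m = mk⇔ (solve m) λ { refl → cong just (x-[x-y]≡y x b) }
    where
    solve : ∀ m → just x +∞ (-∞ m) ≡ just b → m ≡ just (x -ᵍ b)
    solve (just y) x-y≡b = cong just (trans (sym (x-[x-y]≡y x y)) (cong (λ z → x -ᵍ z) (just-injective x-y≡b)))

  -- When w k = ψ(u k − b) this says u k is farther from b than u l, without mentioning b.
  Farther : {I : Set} → (u w : I → Γ) → I → I → Set
  Farther u w k l = ψ (u k -ᵍ u l) ≡ just (w k) × w k <ᵍ w l

  farther-anchored : {I : Set} {u w : I → Γ} {b : Γ} {c l : I} →
                     Farther u w c l → ψ (u l -ᵍ b) ≡ just (w l) → ψ (u c -ᵍ b) ≡ just (w c)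
  farther-anchored {u = u} {b = b} {l = l} (ψ[c-l] , wc<wl) ψl =
    ψ-isosceles ψ[c-l] (trans (ψ[x-y]≡ψ[y-x] b (u l)) ψl) wc<wl

  anchor-extends : {I : Set} (u w : I → Γ) (b : Γ) {i c j : I} →
                   (Farther u w i j → Farther u w c j) →
                   (Farther u w j i → Farther u w c i) →
                   w i ≢ w j →
                   ψ (u i -ᵍ b) ≡ just (w i) → ψ (u j -ᵍ b) ≡ just (w j) →
                   ψ (u c -ᵍ b) ≡ just (w c)
  anchor-extends u w b {i} {c} {j} replace-i replace-j wi≢wj ψi ψj with <-tri (w i) (w j)
  ... | inj₁ wi<wj        = farther-anchored {u = u} {w} (replace-i (ψ-isosceles ψi ψj wi<wj , wi<wj)) ψj
  ... | inj₂ (inj₁ wi≡wj) = ⊥-elim (wi≢wj wi≡wj)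
  ... | inj₂ (inj₂ wj<wi) = farther-anchored {u = u} {w} (replace-j (ψ-isosceles ψj ψi wj<wi , wj<wi)) ψi

_t−_ : ∀ {n} → Term n → Term n → Term n
t t− u = t t+ t- u

farther-φ : ∀ {n} (uₖ uₗ wₖ wₗ : Term n) → Formula n
farther-φ uₖ uₗ wₖ wₗ = (tψ (uₖ t− uₗ) ≐ wₖ) ∧' (wₖ ≺ wₗ)

module Pairs (S : LogStructure) {I : Set} (_<I_ : I → I → Set) (a a' : I → LogStructure.Γ S)
             (indiscernible : Semantics.IndiscernibleOver S _<I_ (λ _ → ⊤) noParams a a') where
  open Semantics S

  pair : I → I → Fin 2 → I
  pair i j fzero    = i
  pair i j (fsuc _) = j

  pair-increasing : ∀ {i j} → i <I j → Increasing _<I_ (pair i j)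
  pair-increasing i<j fzero    (fsuc fzero) _         = i<j
  pair-increasing i<j (fsuc fzero) (fsuc fzero) (s≤s ())

  -- Variables of a formula about a pair (k, l): a_k, a_l, a'_k, a'_l.
  a₀ a₁ a'₀ a'₁ : Term 4
  a₀  = var fzero
  a₁  = var (fsuc fzero)
  a'₀ = var (fsuc (fsuc fzero))
  a'₁ = var (fsuc (fsuc (fsuc fzero)))

  transfer : (φ : Formula 4) → ∀ {i j k l} → i <I j → k <I l →
             Sat φ (envOf noParams a a' (pair i j)) → Sat φ (envOf noParams a a' (pair k l))
  transfer φ i<j k<l =
    proj₁ (indiscernible 2 φ (pair _ _) (pair _ _) (pair-increasing i<j) (pair-increasing k<l)
                         (λ _ → tt) (λ _ → tt))

  nonConstant⇒distinct : IsStrictTotalOrder _≡_ _<I_ → NonConstant a' → ∀ {i j} → i <I j → a' i ≢ a' j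
  nonConstant⇒distinct sto (k , l , a'k≢a'l) i<j a'i≡a'j with IsStrictTotalOrder.compare sto k l
  ... | tri< k<l _ _ = a'k≢a'l (just-injective (transfer (a'₀ ≐ a'₁) i<j k<l (cong just a'i≡a'j)))
  ... | tri≈ _ k≡l _ = a'k≢a'l (cong a' k≡l)
  ... | tri> _ _ l<k = a'k≢a'l (sym (just-injective (transfer (a'₀ ≐ a'₁) i<j l<k (cong just a'i≡a'j))))

module Clauses (S : LogStructure) (T : IsTlog S) {I : Set} (_<I_ : I → I → Set)
               (a a' : I → LogStructure.Γ S)
               (indiscernible : Semantics.IndiscernibleOver S _<I_ (λ _ → ⊤) noParams a a')
               {i c j : I} (i<c : i <I c) (c<j : c <I j) (i<j : i <I j) (a'i≢a'j : a' i ≢ a' j)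
               (b : LogStructure.Γ S) where
  open LogStructure S
  open LogDefs S
  open IsTlog T using (p-def)
  open Tlog S T
  open Pairs S _<I_ a a' indiscernible
  open Equivalence using (to; from)

  ψ-clause : ψ (a i -ᵍ b) ≡ just (a' i) → ψ (a j -ᵍ b) ≡ just (a' j) → ψ (a c -ᵍ b) ≡ just (a' c)
  ψ-clause = anchor-extends a a' b
    (transfer (farther-φ a₀ a₁ a'₀ a'₁) i<j c<j)
    (transfer (farther-φ a₁ a₀ a'₁ a'₀) i<j i<c)
    a'i≢a'j

  s-clause : s (a i -ᵍ b) ≡ just (a' i) → s (a j -ᵍ b) ≡ just (a' j) → s (a c -ᵍ b) ≡ just (a' c)
  s-clause si sj = from (shift c) (anchor-extends (λ k → a k -ᵍ a' k) a' b
      (transfer (farther-φ (a₀ t− a'₀) (a₁ t− a'₁) a'₀ a'₁) i<j c<j)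
      (transfer (farther-φ (a₁ t− a'₁) (a₀ t− a'₀) a'₁ a'₀) i<j i<c)
      a'i≢a'j (to (shift i) si) (to (shift j) sj))
    where
    shift : ∀ k → s (a k -ᵍ b) ≡ just (a' k) ⇔ ψ ((a k -ᵍ a' k) -ᵍ b) ≡ just (a' k)
    shift k = s[x-b]≡y⇔ψ[x-y-b]≡y (a k) b (a' k)

  p-clause : InΨ (a' c) →
             p (a i -ᵍ b) ≡ just (a' i) → p (a j -ᵍ b) ≡ just (a' j) → p (a c -ᵍ b) ≡ just (a' c)
  p-clause a'c∈Ψ pi pj =
    p-def (a' c) (a c -ᵍ b) a'c∈Ψ (to (offset c) (trans (sym offset-transferred) (from (offset i) (p≡⇒s≡ pi))))
    where
    offset : ∀ k → just (a k) +∞ (-∞ s (a' k)) ≡ just b ⇔ s (a' k) ≡ just (a k -ᵍ b)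
    offset k = just-x-m≡b⇔m≡x-b (a k) b (s (a' k))
    offset-transferred : just (a i) +∞ (-∞ s (a' i)) ≡ just (a c) +∞ (-∞ s (a' c))
    offset-transferred = transfer ((a₀ t− ts a'₀) ≐ (a₁ t− ts a'₁)) i<j i<c
      (trans (from (offset i) (p≡⇒s≡ pi)) (sym (from (offset j) (p≡⇒s≡ pj))))

lemma4p2 : (S : LogStructure) → IsTlog S →
    (I : Set) (_<I_ : I → I → Set) → IsStrictTotalOrder _≡_ _<I_ →
    (c : I) → InfiniteSubset (λ i → i <I c) → InfiniteSubset (λ i → c <I i) →
    (a a' : I → LogStructure.Γ S) → (∀ i → LogDefs.InΨ S (a' i)) →
    Semantics.IndiscernibleOver S _<I_ (λ _ → ⊤) noParams a a' →
    NonConstant a → NonConstant a' →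
    (b : LogStructure.Γ S) → Semantics.IndiscernibleOver S _<I_ (λ i → i ≢ c) (oneParam (just b)) a a' →
    ((∀ i → i ≢ c → LogStructure.ψ S (LogDefs._-ᵍ_ S (a i) b) ≡ just (a' i)) → LogStructure.ψ S (LogDefs._-ᵍ_ S (a c) b) ≡ just (a' c)) ×
    ((∀ i → i ≢ c → LogStructure.s S (LogDefs._-ᵍ_ S (a i) b) ≡ just (a' i)) → LogStructure.s S (LogDefs._-ᵍ_ S (a c) b) ≡ just (a' c)) ×
    ((∀ i → i ≢ c → LogStructure.p S (LogDefs._-ᵍ_ S (a i) b) ≡ just (a' i)) → LogStructure.p S (LogDefs._-ᵍ_ S (a c) b) ≡ just (a' c))
lemma4p2 S T I _<I_ sto c (below , _ , below<c) (above , _ , c<above) a a' a'∈Ψ indiscernible _ a'-nonConstant b _ =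
  (λ h → ψ-clause (h i i≢c) (h j j≢c)) ,
  (λ h → s-clause (h i i≢c) (h j j≢c)) ,
  (λ h → p-clause (a'∈Ψ c) (h i i≢c) (h j j≢c))
  where
  module < = IsStrictTotalOrder sto
  i j : I
  i = below 0
  j = above 0
  i<c : i <I c
  i<c = below<c 0
  c<j : c <I j
  c<j = c<above 0
  i≢c : i ≢ c
  i≢c i≡c = <.irrefl i≡c i<c
  j≢c : j ≢ c
  j≢c j≡c = <.irrefl (sym j≡c) c<j
  i<j : i <I j
  i<j = <.trans i<c c<j
  open Clauses S T _<I_ a a' indiscernible i<c c<j i<j
    (Pairs.nonConstant⇒distinct S _<I_ a a' indiscernible sto a'-nonConstant i<j) b
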